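{- Let $G$ be a $(d,k)$-digraph with repeat permutation $r$, let $\alpha>1$ be an integer, and let $H_\alpha$ be the subdigraph of $G$ induced by the vertices $w$ for which there is an integer $t\geq0$ with $\mathrm{ord}_r(w)\mid 2^t\alpha$. Then for every vertex $v$ of $H_\alpha$, its out-degree in $H_\alpha$ equals its in-degree in $H_\alpha$: $d^+_{H_\alpha}(v)=d^-_{H_\alpha}(v)$.
   Context: A $(d,k)$-digraph (almost Moore digraph) is a finite digraph, diregular of degree $d>1$ (every vertex has in- and out-degree $d$), of diameter $k>1$ and order $N=d+d^2+\cdots+d^k$. Every vertex $v$ has a unique vertex $r(v)$ (its repeat) such that there are exactly two walks of length $\leq k$ from $v$ to $r(v)$, at least one of them of length $k$; $r$ is a permutation of $V(G)$ and an automorphism of $G$. $\mathrm{ord}_r(v)$ is the least $t\geq1$ with $r^t(v)=v$. -}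

module Defs where

open import Data.Nat using (ℕ; zero; suc; _+_; _*_; _∸_; _^_; _≤_; _<_)
open import Data.Nat.Divisibility using (_∣_)
open import Data.Fin using (Fin; zero; suc)
open import Data.Fin.Properties using (_≟_)
open import Data.Bool using (Bool; true; false; _∧_; T)
open import Data.Product using (Σ; _×_; ∃; ∃-syntax; _,_)
open import Relation.Nullary using (¬_; yes; no)
open import Relation.Binary.PropositionalEquality using (_≡_)

-- A finite digraph on vertex set Fin n (loops allowed, no multiple arcs),
-- given by its 0/1 adjacency relation: adj u v = true iff there is an arc u → v.
Digraph : ℕ → Set
Digraph n = Fin n → Fin n → Bool

b2n : Bool → ℕ
b2n true  = 1
b2n false = 0

sumFin : (n : ℕ) → (Fin n → ℕ) → ℕ
sumFin zero    f = 0
sumFin (suc n) f = f zero + sumFin n (λ i → f (suc i))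

count : {n : ℕ} → (Fin n → Bool) → ℕ
count {n} p = sumFin n (λ i → b2n (p i))

outDeg : {n : ℕ} → Digraph n → Fin n → ℕ
outDeg G v = count (λ w → G v w)

inDeg : {n : ℕ} → Digraph n → Fin n → ℕ
inDeg G v = count (λ w → G w v)

walks : {n : ℕ} → Digraph n → ℕ → Fin n → Fin n → ℕ
walks G zero u v with u ≟ v
... | yes _ = 1
... | no  _ = 0
walks {n} G (suc ℓ) u v = sumFin n (λ w → b2n (G u w) * walks G ℓ w v)

walksUpTo : {n : ℕ} → Digraph n → ℕ → Fin n → Fin n → ℕ
walksUpTo G zero    u v = walks G zero u v
walksUpTo G (suc k) u v = walksUpTo G k u v + walks G (suc k) u v

Reach≤ : {n : ℕ} → Digraph n → ℕ → Fin n → Fin n → Set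
Reach≤ G ℓ u v = ∃[ m ] (m ≤ ℓ × 1 ≤ walks G m u v)

HasDiameter : {n : ℕ} → Digraph n → ℕ → Set
HasDiameter G k = (∀ u v → Reach≤ G k u v) × (∃[ u ] ∃[ v ] ¬ Reach≤ G (k ∸ 1) u v)

Diregular : {n : ℕ} → Digraph n → ℕ → Set
Diregular G d = ∀ v → outDeg G v ≡ d × inDeg G v ≡ d

mooreSum : ℕ → ℕ → ℕ
mooreSum d zero    = 0
mooreSum d (suc k) = mooreSum d k + d ^ suc k

IsAlmostMoore : (d k : ℕ) → Digraph (mooreSum d k) → Set
IsAlmostMoore d k G = 1 < d × 1 < k × Diregular G d × HasDiameter G k

IsRepeatOf : {n : ℕ} → Digraph n → ℕ → Fin n → Fin n → Set
IsRepeatOf G k v w = walksUpTo G k v w ≡ 2 × 1 ≤ walks G k v w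

IsRepeatMap : {n : ℕ} → Digraph n → ℕ → (Fin n → Fin n) → Set
IsRepeatMap G k r = ∀ v → IsRepeatOf G k v (r v) × (∀ w → IsRepeatOf G k v w → w ≡ r v)

iter : {A : Set} → (A → A) → ℕ → A → A
iter f zero    x = x
iter f (suc m) x = f (iter f m x)

IsOrd : {n : ℕ} → (Fin n → Fin n) → Fin n → ℕ → Set
IsOrd r w m = 1 ≤ m × iter r m w ≡ w × (∀ j → 1 ≤ j → j < m → ¬ (iter r j w ≡ w))

InH : {n : ℕ} → (Fin n → Fin n) → ℕ → Fin n → Set
InH r α w = ∃[ m ] (IsOrd r w m × ∃[ t ] (m ∣ 2 ^ t * α))

outDegIn : {n : ℕ} → Digraph n → (Fin n → Bool) → Fin n → ℕ
outDegIn G S v = count (λ w → G v w ∧ S w)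

inDegIn : {n : ℕ} → Digraph n → (Fin n → Bool) → Fin n → ℕ
inDegIn G S v = count (λ w → G w v ∧ S w)

Fin' : ℕ → ℕ → Set
Fin' d k = Fin (mooreSum d k)

-- Write A for the adjacency matrix of G and P for the permutation matrix of r. Counting walks gives
-- I + A + ⋯ + A^k = J + P; since A commutes with I + A + ⋯ + A^k and (G being diregular) with J, it
-- commutes with P, so r is an automorphism of G. If u, w lie in H_α, some M = 2^t α is a period of
-- both, so for j + l ≤ k the function c(y) = A^j(u, y) A^l(y, w) is invariant under r^M. A vertex y
-- outside H_α is not fixed by r^(2M), so its r^M-orbit has at least three points, whereas
-- Σ_y c(y) = A^(j+l)(u, w) ≤ (J + P)(u, w) ≤ 2; hence c(y) = 0: walks of length ≤ k between vertices
-- of H_α stay inside H_α. Therefore the adjacency matrix A_H of H_α commutes with J + P on the rows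
-- and columns of H_α, and the (v, v) entries of A_H (J + P) and (J + P) A_H are
-- d⁺(v) + A(r v, v) and d⁻(v) + A(r v, v).
module Submission where

open import Defs
open import Data.Bool using (Bool; true; false; T; _∧_)
open import Data.Bool.Properties using (∧-comm)
open import Data.Empty using (⊥-elim)
open import Data.Fin using (Fin; zero; suc)
open import Data.Fin.Properties using (_≟_)
open import Data.Nat using (ℕ; zero; suc; _+_; _*_; _^_; _≤_; _<_; _≤?_; z≤n; s≤s)
open import Data.Nat.Divisibility using (_∣_; divides; ∣-trans; *-monoˡ-∣; m%n≡0⇒n∣m)
open import Data.Nat.DivMod using (_%_; _/_; m≡m%n+[m/n]*n; m%n<n)
open import Data.Nat.Induction using (<-rec)
open import Data.Nat.Properties hiding (_≟_)
open import Data.Product using (_×_; _,_; proj₁; proj₂; ∃-syntax)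
open import Data.Sum using (inj₁; inj₂)
open import Data.Unit using (tt)
open import Function using (_∘_; Injective; _⇔_; mk⇔; Equivalence)
open import Function.Properties.Equivalence using () renaming (sym to ⇔-sym)
open import Relation.Binary.PropositionalEquality
open import Relation.Nullary using (¬_; yes; no)
open import Relation.Nullary.Decidable using (_×-dec_; T?)
open import Relation.Unary using (Decidable)
open import Algebra.Properties.Semiring.Sum +-*-semiring
  using (sum; sum-cong-≗; ∑-distrib-+; ∑-comm; *-distribˡ-sum; *-distribʳ-sum)

δ : ∀ {n} → Fin n → Fin n → ℕ
δ zero    zero    = 1
δ zero    (suc _) = 0
δ (suc _) zero    = 0
δ (suc a) (suc b) = δ a b

δ-refl : ∀ {n} (a : Fin n) → δ a a ≡ 1
δ-refl zero    = refl
δ-refl (suc a) = δ-refl a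

δ-≢ : ∀ {n} {a b : Fin n} → a ≢ b → δ a b ≡ 0
δ-≢ {a = zero}  {zero}  a≢b = ⊥-elim (a≢b refl)
δ-≢ {a = zero}  {suc _} _   = refl
δ-≢ {a = suc _} {zero}  _   = refl
δ-≢ {a = suc a} {suc b} a≢b = δ-≢ (a≢b ∘ cong suc)

δ-sym : ∀ {n} (a b : Fin n) → δ a b ≡ δ b a
δ-sym zero    zero    = refl
δ-sym zero    (suc _) = refl
δ-sym (suc _) zero    = refl
δ-sym (suc a) (suc b) = δ-sym a b

δ-≤1 : ∀ {n} (a b : Fin n) → δ a b ≤ 1
δ-≤1 a b with a ≟ b
... | yes refl = ≤-reflexive (δ-refl a)
... | no  a≢b  = ≤-trans (≤-reflexive (δ-≢ a≢b)) z≤n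

δ-injective : ∀ {n} {f : Fin n → Fin n} → Injective _≡_ _≡_ f → ∀ a b → δ (f a) (f b) ≡ δ a b
δ-injective {f = f} f-injective a b with a ≟ b
... | yes refl = trans (δ-refl (f a)) (sym (δ-refl a))
... | no  a≢b  = trans (δ-≢ (a≢b ∘ f-injective)) (sym (δ-≢ a≢b))

δ-+-≤1 : ∀ {n} (a : Fin n) {w : Fin n → ℕ} → (∀ i → w i ≤ 1) → w a ≡ 0 → ∀ i → δ a i + w i ≤ 1
δ-+-≤1 a {w} w≤1 wa≡0 i with a ≟ i
... | yes refl = ≤-reflexive (cong₂ _+_ (δ-refl a) wa≡0)
... | no  a≢i  = subst (_≤ 1) (cong (_+ w i) (sym (δ-≢ a≢i))) (w≤1 i)

δ-+-δ-≤1 : ∀ {n} {a b : Fin n} → a ≢ b → ∀ i → δ a i + δ b i ≤ 1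
δ-+-δ-≤1 {a = a} {b} a≢b = δ-+-≤1 a (δ-≤1 b) (δ-≢ (a≢b ∘ sym))

sumFin≡sum : ∀ n (f : Fin n → ℕ) → sumFin n f ≡ sum f
sumFin≡sum zero    f = refl
sumFin≡sum (suc n) f = cong (f zero +_) (sumFin≡sum n (λ i → f (suc i)))

sum-const : ∀ n c → sum {n} (λ _ → c) ≡ n * c
sum-const zero    c = refl
sum-const (suc n) c = cong (c +_) (sum-const n c)

sum-δˡ : ∀ {n} (a : Fin n) (f : Fin n → ℕ) → sum (λ i → δ a i * f i) ≡ f a
sum-δˡ {suc n} zero    f =
  trans (cong₂ _+_ (+-identityʳ (f zero)) (trans (sum-const n 0) (*-zeroʳ n))) (+-identityʳ (f zero))
sum-δˡ {suc n} (suc a) f = sum-δˡ a (λ i → f (suc i))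

sum-δʳ : ∀ {n} (a : Fin n) (f : Fin n → ℕ) → sum (λ i → f i * δ i a) ≡ f a
sum-δʳ a f = trans (sum-cong-≗ (λ i → trans (*-comm (f i) _) (cong (_* f i) (δ-sym i a)))) (sum-δˡ a f)

sum-δ : ∀ {n} (a : Fin n) → sum (δ a) ≡ 1
sum-δ a = trans (sum-cong-≗ (λ i → sym (*-identityʳ (δ a i)))) (sum-δˡ a (λ _ → 1))

sum-mono-≤ : ∀ {n} {f g : Fin n → ℕ} → (∀ i → f i ≤ g i) → sum f ≤ sum g
sum-mono-≤ {zero}  f≤g = z≤n
sum-mono-≤ {suc n} f≤g = +-mono-≤ (f≤g zero) (sum-mono-≤ (f≤g ∘ suc))

sum-mono-≤-≡⇒≗ : ∀ {n} {f g : Fin n → ℕ} → (∀ i → f i ≤ g i) → sum f ≡ sum g →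
                 ∀ i → f i ≡ g i
sum-mono-≤-≡⇒≗ {suc n} {f} {g} f≤g eq = λ where
    zero    → f₀≡g₀
    (suc i) → sum-mono-≤-≡⇒≗ (f≤g ∘ suc) tail-sums i
  where
  f₀≡g₀ : f zero ≡ g zero
  f₀≡g₀ = ≤-antisym (f≤g zero)
    (+-cancelʳ-≤ _ _ _ (≤-trans (+-monoʳ-≤ (g zero) (sum-mono-≤ (f≤g ∘ suc))) (≤-reflexive (sym eq))))
  tail-sums : sum (f ∘ suc) ≡ sum (g ∘ suc)
  tail-sums = +-cancelˡ-≡ (f zero) _ _ (trans eq (cong (_+ _) (sym f₀≡g₀)))

sum-weighted-≤ : ∀ {n} {w : Fin n → ℕ} (f : Fin n → ℕ) → (∀ i → w i ≤ 1) →
                 sum (λ i → w i * f i) ≤ sum f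
sum-weighted-≤ f w≤1 =
  sum-mono-≤ (λ i → ≤-trans (*-monoˡ-≤ (f i) (w≤1 i)) (≤-reflexive (*-identityˡ (f i))))

sum-δ-+ : ∀ {n} (a : Fin n) (w f : Fin n → ℕ) →
          sum (λ i → (δ a i + w i) * f i) ≡ f a + sum (λ i → w i * f i)
sum-δ-+ a w f = trans (sum-cong-≗ (λ i → *-distribʳ-+ (f i) (δ a i) (w i)))
  (trans (∑-distrib-+ (λ i → δ a i * f i) (λ i → w i * f i)) (cong (_+ _) (sum-δˡ a f)))

sum-≥-pair : ∀ {n} {a b : Fin n} (f : Fin n → ℕ) → a ≢ b → f a + f b ≤ sum f
sum-≥-pair {a = a} {b} f a≢b = begin
  f a + f b                          ≡⟨ cong (f a +_) (sum-δˡ b f) ⟨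
  f a + sum (λ i → δ b i * f i)      ≡⟨ sum-δ-+ a (δ b) f ⟨
  sum (λ i → (δ a i + δ b i) * f i)  ≤⟨ sum-weighted-≤ f (δ-+-δ-≤1 a≢b) ⟩
  sum f                              ∎
  where open ≤-Reasoning

sum-≥-triple : ∀ {n} {a b c : Fin n} (f : Fin n → ℕ) → a ≢ b → a ≢ c → b ≢ c →
               f a + (f b + f c) ≤ sum f
sum-≥-triple {a = a} {b} {c} f a≢b a≢c b≢c = begin
  f a + (f b + f c)                            ≡⟨ cong (λ x → f a + (f b + x)) (sum-δˡ c f) ⟨
  f a + (f b + sum (λ i → δ c i * f i))        ≡⟨ cong (f a +_) (sum-δ-+ b (δ c) f) ⟨
  f a + sum (λ i → (δ b i + δ c i) * f i)      ≡⟨ sum-δ-+ a (λ i → δ b i + δ c i) f ⟨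
  sum (λ i → (δ a i + (δ b i + δ c i)) * f i)  ≤⟨ sum-weighted-≤ f weight≤1 ⟩
  sum f                                        ∎
  where
  open ≤-Reasoning
  weight≤1 : ∀ i → δ a i + (δ b i + δ c i) ≤ 1
  weight≤1 = δ-+-≤1 a (δ-+-δ-≤1 b≢c) (cong₂ _+_ (δ-≢ (a≢b ∘ sym)) (δ-≢ (a≢c ∘ sym)))

sum-≥-orbit : ∀ {n} {ψ : Fin n → Fin n} (f : Fin n → ℕ) → Injective _≡_ _≡_ ψ →
              (∀ z → f (ψ z) ≡ f z) → ∀ {y} → ψ (ψ y) ≢ y → 3 * f y ≤ sum f
sum-≥-orbit {ψ = ψ} f ψ-injective invariant {y} ψψy≢y = begin
  3 * f y                         ≡⟨ cong (f y +_) (cong₂ _+_ (sym (invariant y)) f[ψψy]≡fy) ⟩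
  f y + (f (ψ y) + f (ψ (ψ y)))   ≤⟨ sum-≥-triple f (ψy≢y ∘ sym) (ψψy≢y ∘ sym) (ψy≢y ∘ sym ∘ ψ-injective) ⟩
  sum f                           ∎
  where
  open ≤-Reasoning
  ψy≢y : ψ y ≢ y
  ψy≢y e = ψψy≢y (trans (cong ψ e) e)
  f[ψψy]≡fy : f y + 0 ≡ f (ψ (ψ y))
  f[ψψy]≡fy = trans (+-identityʳ (f y)) (sym (trans (invariant (ψ y)) (invariant y)))

Matrix : ℕ → Set
Matrix n = Fin n → Fin n → ℕ

infixl 7 _∙_

_∙_ : ∀ {n} → Matrix n → Matrix n → Matrix n
(M ∙ N) u w = sum (λ y → M u y * N y w)

Commute : ∀ {n} → Matrix n → Matrix n → Set
Commute M N = ∀ u w → (M ∙ N) u w ≡ (N ∙ M) u w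

permutationMatrix : ∀ {n} → (Fin n → Fin n) → Matrix n
permutationMatrix r u w = δ (r u) w

module _ {n : ℕ} where

  ∙-congˡ : ∀ {M M′ : Matrix n} (N : Matrix n) → (∀ u y → M u y ≡ M′ u y) →
            ∀ u w → (M ∙ N) u w ≡ (M′ ∙ N) u w
  ∙-congˡ N eq u w = sum-cong-≗ (λ y → cong (_* N y w) (eq u y))

  ∙-congʳ : ∀ (M : Matrix n) {N N′ : Matrix n} → (∀ y w → N y w ≡ N′ y w) →
            ∀ u w → (M ∙ N) u w ≡ (M ∙ N′) u w
  ∙-congʳ M eq u w = sum-cong-≗ (λ y → cong (M u y *_) (eq y w))

  ∙-assoc : ∀ (M N L : Matrix n) u w → (M ∙ N ∙ L) u w ≡ (M ∙ (N ∙ L)) u w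
  ∙-assoc M N L u w = begin
    sum (λ y → sum (λ x → M u x * N x y) * L y w)
      ≡⟨ sum-cong-≗ (λ y → *-distribʳ-sum (L y w) (λ x → M u x * N x y)) ⟩
    sum (λ y → sum (λ x → M u x * N x y * L y w))
      ≡⟨ ∑-comm (λ y x → M u x * N x y * L y w) ⟩
    sum (λ x → sum (λ y → M u x * N x y * L y w))
      ≡⟨ sum-cong-≗ (λ x → sum-cong-≗ (λ y → *-assoc (M u x) (N x y) (L y w))) ⟩
    sum (λ x → sum (λ y → M u x * (N x y * L y w)))
      ≡⟨ sum-cong-≗ (λ x → *-distribˡ-sum (M u x) (λ y → N x y * L y w)) ⟨
    sum (λ x → M u x * sum (λ y → N x y * L y w))
      ∎
    where open ≡-Reasoning

  ∙-distribˡ-+ : ∀ (M N L : Matrix n) u w →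
                 (M ∙ (λ y v → N y v + L y v)) u w ≡ (M ∙ N) u w + (M ∙ L) u w
  ∙-distribˡ-+ M N L u w = trans (sum-cong-≗ (λ y → *-distribˡ-+ (M u y) (N y w) (L y w)))
                                 (∑-distrib-+ (λ y → M u y * N y w) (λ y → M u y * L y w))

  ∙-distribʳ-+ : ∀ (M N L : Matrix n) u w →
                 ((λ v y → N v y + L v y) ∙ M) u w ≡ (N ∙ M) u w + (L ∙ M) u w
  ∙-distribʳ-+ M N L u w = trans (sum-cong-≗ (λ y → *-distribʳ-+ (M y w) (N u y) (L u y)))
                                 (∑-distrib-+ (λ y → N u y * M y w) (λ y → L u y * M y w))

  ∙-identityˡ : ∀ (M : Matrix n) u w → (δ ∙ M) u w ≡ M u w
  ∙-identityˡ M u w = sum-δˡ u (λ y → M y w)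

  ∙-identityʳ : ∀ (M : Matrix n) u w → (M ∙ δ) u w ≡ M u w
  ∙-identityʳ M u w = sum-δʳ w (M u)

  permutationMatrix-∙ : ∀ (r : Fin n → Fin n) (M : Matrix n) u w → (permutationMatrix r ∙ M) u w ≡ M (r u) w
  permutationMatrix-∙ r M u w = sum-δˡ (r u) (λ y → M y w)

  rowSum-∙ : ∀ (M N : Matrix n) {c} → (∀ y → sum (N y) ≡ c) → ∀ u → sum ((M ∙ N) u) ≡ sum (M u) * c
  rowSum-∙ M N {c} rowSum-N u = begin
    sum (λ w → sum (λ y → M u y * N y w))
      ≡⟨ ∑-comm (λ w y → M u y * N y w) ⟩
    sum (λ y → sum (λ w → M u y * N y w))
      ≡⟨ sum-cong-≗ (λ y → trans (sym (*-distribˡ-sum (M u y) (N y))) (cong (M u y *_) (rowSum-N y))) ⟩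
    sum (λ y → M u y * c)
      ≡⟨ *-distribʳ-sum c (M u) ⟨
    sum (M u) * c
      ∎
    where open ≡-Reasoning

  colSum-∙ : ∀ (M N : Matrix n) {c} → (∀ y → sum (λ u → M u y) ≡ c) →
             ∀ w → sum (λ u → (M ∙ N) u w) ≡ c * sum (λ y → N y w)
  colSum-∙ M N {c} colSum-M w = begin
    sum (λ u → sum (λ y → M u y * N y w))
      ≡⟨ ∑-comm (λ u y → M u y * N y w) ⟩
    sum (λ y → sum (λ u → M u y * N y w))
      ≡⟨ sum-cong-≗ (λ y → trans (sym (*-distribʳ-sum (N y w) (λ u → M u y))) (cong (_* N y w) (colSum-M y))) ⟩
    sum (λ y → c * N y w)
      ≡⟨ *-distribˡ-sum c (λ y → N y w) ⟨
    c * sum (λ y → N y w)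
      ∎
    where open ≡-Reasoning

adjacency : ∀ {n} → Digraph n → Matrix n
adjacency G u w = b2n (G u w)

module _ {n : ℕ} (G : Digraph n) where

  private
    A : Matrix n
    A = adjacency G

  walks-zero : ∀ u w → walks G 0 u w ≡ δ u w
  walks-zero u w with u ≟ w
  ... | yes refl = sym (δ-refl u)
  ... | no  u≢w  = sym (δ-≢ u≢w)

  walks-suc : ∀ l u w → walks G (suc l) u w ≡ (A ∙ walks G l) u w
  walks-suc l u w = sumFin≡sum n (λ y → A u y * walks G l y w)

  walks-one : ∀ u w → walks G 1 u w ≡ A u w
  walks-one u w = trans (walks-suc 0 u w) (trans (∙-congʳ A walks-zero u w) (∙-identityʳ A u w))

  walks-commute : ∀ {M} → Commute A M → ∀ l → Commute (walks G l) M
  walks-commute {M} AM zero u w = begin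
    (walks G 0 ∙ M) u w  ≡⟨ ∙-congˡ M walks-zero u w ⟩
    (δ ∙ M) u w          ≡⟨ trans (∙-identityˡ M u w) (sym (∙-identityʳ M u w)) ⟩
    (M ∙ δ) u w          ≡⟨ ∙-congʳ M walks-zero u w ⟨
    (M ∙ walks G 0) u w  ∎
    where open ≡-Reasoning
  walks-commute {M} AM (suc l) u w = begin
    (walks G (suc l) ∙ M) u w  ≡⟨ ∙-congˡ M (walks-suc l) u w ⟩
    (A ∙ walks G l ∙ M) u w    ≡⟨ ∙-assoc A (walks G l) M u w ⟩
    (A ∙ (walks G l ∙ M)) u w  ≡⟨ ∙-congʳ A (walks-commute AM l) u w ⟩
    (A ∙ (M ∙ walks G l)) u w  ≡⟨ ∙-assoc A M (walks G l) u w ⟨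
    (A ∙ M ∙ walks G l) u w    ≡⟨ ∙-congˡ (walks G l) AM u w ⟩
    (M ∙ A ∙ walks G l) u w    ≡⟨ ∙-assoc M A (walks G l) u w ⟩
    (M ∙ (A ∙ walks G l)) u w  ≡⟨ ∙-congʳ M (walks-suc l) u w ⟨
    (M ∙ walks G (suc l)) u w  ∎
    where open ≡-Reasoning

  adjacency-commute-walks : ∀ l → Commute A (walks G l)
  adjacency-commute-walks l u w = sym (walks-commute {A} (λ _ _ → refl) l u w)

  walks-sucʳ : ∀ l u w → walks G (suc l) u w ≡ (walks G l ∙ A) u w
  walks-sucʳ l u w = trans (walks-suc l u w) (adjacency-commute-walks l u w)

  walks-+ : ∀ j l u w → walks G (j + l) u w ≡ (walks G j ∙ walks G l) u w
  walks-+ zero    l u w = sym (trans (∙-congˡ (walks G l) walks-zero u w) (∙-identityˡ (walks G l) u w))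
  walks-+ (suc j) l u w = begin
    walks G (suc (j + l)) u w          ≡⟨ walks-suc (j + l) u w ⟩
    (A ∙ walks G (j + l)) u w          ≡⟨ ∙-congʳ A (walks-+ j l) u w ⟩
    (A ∙ (walks G j ∙ walks G l)) u w  ≡⟨ ∙-assoc A (walks G j) (walks G l) u w ⟨
    (A ∙ walks G j ∙ walks G l) u w    ≡⟨ ∙-congˡ (walks G l) (walks-suc j) u w ⟨
    (walks G (suc j) ∙ walks G l) u w  ∎
    where open ≡-Reasoning

  adjacency-commute-walksUpTo : ∀ k → Commute A (walksUpTo G k)
  adjacency-commute-walksUpTo zero        = adjacency-commute-walks 0
  adjacency-commute-walksUpTo (suc k) u w = begin
    (A ∙ walksUpTo G (suc k)) u w
      ≡⟨ ∙-distribˡ-+ A (walksUpTo G k) (walks G (suc k)) u w ⟩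
    (A ∙ walksUpTo G k) u w + (A ∙ walks G (suc k)) u w
      ≡⟨ cong₂ _+_ (adjacency-commute-walksUpTo k u w) (adjacency-commute-walks (suc k) u w) ⟩
    (walksUpTo G k ∙ A) u w + (walks G (suc k) ∙ A) u w
      ≡⟨ ∙-distribʳ-+ A (walksUpTo G k) (walks G (suc k)) u w ⟨
    (walksUpTo G (suc k) ∙ A) u w
      ∎
    where open ≡-Reasoning

  walks≤walksUpTo : ∀ {m} k u w → m ≤ k → walks G m u w ≤ walksUpTo G k u w
  walks≤walksUpTo zero    u w z≤n = ≤-refl
  walks≤walksUpTo (suc k) u w m≤1+k with m≤n⇒m<n∨m≡n m≤1+k
  ... | inj₁ (s≤s m≤k) = ≤-trans (walks≤walksUpTo k u w m≤k) (m≤m+n _ _)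
  ... | inj₂ refl      = m≤n+m _ _

  module _ {d : ℕ} (regular : Diregular G d) where

    rowSum-adjacency : ∀ u → sum (A u) ≡ d
    rowSum-adjacency u = trans (sym (sumFin≡sum n (A u))) (proj₁ (regular u))

    colSum-adjacency : ∀ w → sum (λ u → A u w) ≡ d
    colSum-adjacency w = trans (sym (sumFin≡sum n (λ u → A u w))) (proj₂ (regular w))

    rowSum-walks : ∀ l u → sum (walks G l u) ≡ d ^ l
    rowSum-walks zero    u = trans (sum-cong-≗ (walks-zero u)) (sum-δ u)
    rowSum-walks (suc l) u = begin
      sum (walks G (suc l) u)  ≡⟨ sum-cong-≗ (walks-suc l u) ⟩
      sum ((A ∙ walks G l) u)  ≡⟨ rowSum-∙ A (walks G l) (rowSum-walks l) u ⟩
      sum (A u) * d ^ l        ≡⟨ cong (_* d ^ l) (rowSum-adjacency u) ⟩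
      d ^ suc l                ∎
      where open ≡-Reasoning

    colSum-walks : ∀ l w → sum (λ u → walks G l u w) ≡ d ^ l
    colSum-walks zero    w = trans (sum-cong-≗ (λ u → trans (walks-zero u w) (δ-sym u w))) (sum-δ w)
    colSum-walks (suc l) w = begin
      sum (λ u → walks G (suc l) u w)  ≡⟨ sum-cong-≗ (λ u → walks-sucʳ l u w) ⟩
      sum (λ u → (walks G l ∙ A) u w)  ≡⟨ colSum-∙ (walks G l) A (colSum-walks l) w ⟩
      d ^ l * sum (λ y → A y w)        ≡⟨ trans (cong (d ^ l *_) (colSum-adjacency w)) (*-comm (d ^ l) d) ⟩
      d ^ suc l                        ∎
      where open ≡-Reasoning

    rowSum-walksUpTo : ∀ k u → sum (walksUpTo G k u) ≡ 1 + mooreSum d k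
    rowSum-walksUpTo zero    u = rowSum-walks 0 u
    rowSum-walksUpTo (suc k) u = trans (∑-distrib-+ (walksUpTo G k u) (walks G (suc k) u))
      (trans (cong₂ _+_ (rowSum-walksUpTo k u) (rowSum-walks (suc k) u)) (+-assoc 1 (mooreSum d k) _))

    colSum-walksUpTo : ∀ k w → sum (λ u → walksUpTo G k u w) ≡ 1 + mooreSum d k
    colSum-walksUpTo zero    w = colSum-walks 0 w
    colSum-walksUpTo (suc k) w = trans (∑-distrib-+ (λ u → walksUpTo G k u w) (λ u → walks G (suc k) u w))
      (trans (cong₂ _+_ (colSum-walksUpTo k w) (colSum-walks (suc k) w)) (+-assoc 1 (mooreSum d k) _))

least-witness : ∀ {p} {P : ℕ → Set p} → Decidable P → ∀ {m} → P m →
                ∃[ j ] (P j × ∀ i → i < j → ¬ P i)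
least-witness {P = P} P? {m} = <-rec Least step m
  where
  Least : ℕ → Set _
  Least m = P m → ∃[ j ] (P j × ∀ i → i < j → ¬ P i)
  step : ∀ m → (∀ {i} → i < m → Least i) → Least m
  step m smaller Pm with anyUpTo? P? m
  ... | yes (i , i<m , Pi) = smaller i<m Pi
  ... | no  none           = m , Pm , λ i i<m Pi → none (i , i<m , Pi)

module _ {n : ℕ} (f : Fin n → Fin n) where

  iter-+ : ∀ a b x → iter f (a + b) x ≡ iter f a (iter f b x)
  iter-+ zero    b x = refl
  iter-+ (suc a) b x = cong f (iter-+ a b x)

  iter-* : ∀ {m x} → iter f m x ≡ x → ∀ c → iter f (c * m) x ≡ x
  iter-*         period zero    = refl
  iter-* {m} {x} period (suc c) = trans (iter-+ m (c * m) x) (trans (cong (iter f m) (iter-* period c)) period)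

  iter-∣ : ∀ {m p x} → iter f m x ≡ x → m ∣ p → iter f p x ≡ x
  iter-∣ period (divides c refl) = iter-* period c

  iter-injective : Injective _≡_ _≡_ f → ∀ a → Injective _≡_ _≡_ (iter f a)
  iter-injective f-injective zero    e = e
  iter-injective f-injective (suc a) e = iter-injective f-injective a (f-injective e)

  iter-fixed-shift : Injective _≡_ _≡_ f → ∀ j x → iter f j (f x) ≡ f x ⇔ iter f j x ≡ x
  iter-fixed-shift f-injective j x =
    mk⇔ (λ e → f-injective (trans (sym (iter-f j)) e)) (λ e → trans (iter-f j) (cong f e))
    where
    iter-f : ∀ j → iter f j (f x) ≡ f (iter f j x)
    iter-f zero    = refl
    iter-f (suc j) = cong f (iter-f j)

  IsOrd⇒∣ : ∀ {x m p} → IsOrd f x m → iter f p x ≡ x → m ∣ p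
  IsOrd⇒∣ {x} {m@(suc _)} {p} (_ , period , minimal) fixed = m%n≡0⇒n∣m p m remainder≡0
    where
    remainder-fixed : iter f (p % m) x ≡ x
    remainder-fixed = begin
      iter f (p % m) x                       ≡⟨ cong (iter f (p % m)) (iter-* period (p / m)) ⟨
      iter f (p % m) (iter f (p / m * m) x)  ≡⟨ iter-+ (p % m) (p / m * m) x ⟨
      iter f (p % m + p / m * m) x           ≡⟨ cong (λ q → iter f q x) (m≡m%n+[m/n]*n p m) ⟨
      iter f p x                             ≡⟨ fixed ⟩
      x                                      ∎
      where open ≡-Reasoning
    remainder≡0 : p % m ≡ 0
    remainder≡0 with p % m in eq
    ... | zero  = refl
    ... | suc q = ⊥-elim (minimal (suc q) (s≤s z≤n) (subst (_< m) eq (m%n<n p m))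
                                  (subst (λ j → iter f j x ≡ x) eq remainder-fixed))

  IsOrd-exists : ∀ {x p} → 1 ≤ p → iter f p x ≡ x → ∃[ m ] IsOrd f x m
  IsOrd-exists {x} 1≤p fixed with least-witness (λ j → 1 ≤? j ×-dec iter f j x ≟ x) (1≤p , fixed)
  ... | m , (1≤m , period) , smaller = m , 1≤m , period , λ j 1≤j j<m fixedʲ → smaller j j<m (1≤j , fixedʲ)

  IsOrd-respects : ∀ {x y m} → (∀ j → iter f j x ≡ x ⇔ iter f j y ≡ y) → IsOrd f x m → IsOrd f y m
  IsOrd-respects {m = m} fixed⇔ (1≤m , period , minimal) =
    1≤m , Equivalence.to (fixed⇔ m) period , λ j 1≤j j<m → minimal j 1≤j j<m ∘ Equivalence.from (fixed⇔ j)

  InH-respects : ∀ {α x y} → (∀ j → iter f j x ≡ x ⇔ iter f j y ≡ y) → InH f α x → InH f α y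
  InH-respects fixed⇔ (m , ord , t , m∣) = m , IsOrd-respects fixed⇔ ord , t , m∣

  InH⇒periodic : ∀ {α x} → InH f α x → ∃[ t ] ∀ s → iter f (2 ^ (t + s) * α) x ≡ x
  InH⇒periodic {α} (m , (_ , period , _) , t , m∣) = t , λ s →
    iter-∣ period (∣-trans m∣ (*-monoˡ-∣ α 2^t∣2^[t+s]))
    where
    2^t∣2^[t+s] : ∀ {s} → 2 ^ t ∣ 2 ^ (t + s)
    2^t∣2^[t+s] {s} = divides (2 ^ s) (trans (^-distribˡ-+-* 2 t s) (*-comm (2 ^ t) (2 ^ s)))

  periodic⇒InH : ∀ {α x} t → 1 ≤ α → iter f (2 ^ t * α) x ≡ x → InH f α x
  periodic⇒InH t 1≤α fixed with IsOrd-exists (*-mono-≤ (m^n>0 2 t) 1≤α) fixed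
  ... | m , ord = m , ord , t , IsOrd⇒∣ ord fixed

induced : ∀ {n} → Digraph n → (Fin n → Bool) → Digraph n
induced G S u w = S u ∧ S w ∧ G u w

NoDetour : ∀ {n} → Digraph n → ℕ → (Fin n → Bool) → Set
NoDetour G k S =
  ∀ {u w y} j l → j + l ≤ k → T (S u) → T (S w) → ¬ T (S y) → walks G j u y * walks G l y w ≡ 0

module _ {n : ℕ} (G : Digraph n) (S : Fin n → Bool) where

  private
    H : Digraph n
    H = induced G S

  adjacency-induced : ∀ {u w} → T (S u) → T (S w) → adjacency H u w ≡ adjacency G u w
  adjacency-induced {u} {w} _ _ with S u | S w
  ... | true | true = refl

  adjacency-induced-outˡ : ∀ {u w} → ¬ T (S u) → adjacency H u w ≡ 0
  adjacency-induced-outˡ {u} ¬su with S u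
  ... | false = refl
  ... | true  = ⊥-elim (¬su tt)

  adjacency-induced-outʳ : ∀ {u w} → ¬ T (S w) → adjacency H u w ≡ 0
  adjacency-induced-outʳ {u} {w} ¬sw with S u | S w
  ... | false | _     = refl
  ... | true  | false = refl
  ... | true  | true  = ⊥-elim (¬sw tt)

  outDegIn-induced : ∀ {v} → T (S v) → outDegIn G S v ≡ sum (adjacency H v)
  outDegIn-induced {v} _ with S v
  ... | true = trans (sumFin≡sum n _) (sum-cong-≗ (λ w → cong b2n (∧-comm (G v w) (S w))))

  inDegIn-induced : ∀ {v} → T (S v) → inDegIn G S v ≡ sum (λ u → adjacency H u v)
  inDegIn-induced {v} _ with S v
  ... | true = trans (sumFin≡sum n _) (sum-cong-≗ (λ u → cong b2n (∧-comm (G u v) (S u))))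

  module _ {k : ℕ} (noDetour : NoDetour G k S) where

    walks-induced : ∀ {m u w} → m ≤ k → T (S u) → T (S w) → walks G m u w ≡ walks H m u w
    walks-induced {zero}  {u} {w} _ _ _ = trans (walks-zero G u w) (sym (walks-zero H u w))
    walks-induced {suc m} {u} {w} 1+m≤k su sw = begin
      walks G (suc m) u w            ≡⟨ walks-suc G m u w ⟩
      (adjacency G ∙ walks G m) u w  ≡⟨ sum-cong-≗ step ⟩
      (adjacency H ∙ walks H m) u w  ≡⟨ walks-suc H m u w ⟨
      walks H (suc m) u w            ∎
      where
      open ≡-Reasoning
      step : ∀ y → adjacency G u y * walks G m y w ≡ adjacency H u y * walks H m y w
      step y with T? (S y)
      ... | yes sy = cong₂ _*_ (sym (adjacency-induced su sy)) (walks-induced (≤-trans (n≤1+n m) 1+m≤k) sy sw)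
      ... | no ¬sy rewrite adjacency-induced-outʳ {u} ¬sy | sym (walks-one G u y) = noDetour 1 m 1+m≤k su sw ¬sy

    walksUpTo-induced : ∀ {k′ u w} → k′ ≤ k → T (S u) → T (S w) →
                        walksUpTo G k′ u w ≡ walksUpTo H k′ u w
    walksUpTo-induced {zero}   k′≤k su sw = walks-induced k′≤k su sw
    walksUpTo-induced {suc k′} k′≤k su sw =
      cong₂ _+_ (walksUpTo-induced (≤-trans (n≤1+n k′) k′≤k) su sw) (walks-induced k′≤k su sw)

    adjacency-induced-commute-walksUpTo : ∀ {u w} → T (S u) → T (S w) →
      (adjacency H ∙ walksUpTo G k) u w ≡ (walksUpTo G k ∙ adjacency H) u w
    adjacency-induced-commute-walksUpTo {u} {w} su sw = begin
      (adjacency H ∙ walksUpTo G k) u w  ≡⟨ sum-cong-≗ into-target ⟩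
      (adjacency H ∙ walksUpTo H k) u w  ≡⟨ adjacency-commute-walksUpTo H k u w ⟩
      (walksUpTo H k ∙ adjacency H) u w  ≡⟨ sum-cong-≗ from-source ⟨
      (walksUpTo G k ∙ adjacency H) u w  ∎
      where
      open ≡-Reasoning
      into-target : ∀ y → adjacency H u y * walksUpTo G k y w ≡ adjacency H u y * walksUpTo H k y w
      into-target y with T? (S y)
      ... | yes sy = cong (adjacency H u y *_) (walksUpTo-induced ≤-refl sy sw)
      ... | no ¬sy rewrite adjacency-induced-outʳ {u} ¬sy = refl
      from-source : ∀ y → walksUpTo G k u y * adjacency H y w ≡ walksUpTo H k u y * adjacency H y w
      from-source y with T? (S y)
      ... | yes sy = cong (_* adjacency H y w) (walksUpTo-induced ≤-refl su sy)
      ... | no ¬sy rewrite adjacency-induced-outˡ {y} {w} ¬sy =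
        trans (*-zeroʳ (walksUpTo G k u y)) (sym (*-zeroʳ (walksUpTo H k u y)))

    outDegIn≡inDegIn : ∀ {r : Fin n → Fin n} →
      (∀ u w → walksUpTo G k u w ≡ 1 + permutationMatrix r u w) →
      Commute (adjacency G) (permutationMatrix r) →
      (∀ w → T (S w) → T (S (r w))) → (∀ w → T (S (r w)) → T (S w)) →
      ∀ {v} → T (S v) → outDegIn G S v ≡ inDegIn G S v
    outDegIn≡inDegIn {r} walksUpTo≡1+P AP≡PA S-r S-r⁻¹ {v} sv = +-cancelʳ-≡ (A (r v) v) _ _ (begin
      outDegIn G S v + A (r v) v
        ≡⟨ cong (outDegIn G S v +_) (trans (AP≡PA v v) (permutationMatrix-∙ r A v v)) ⟨
      outDegIn G S v + (A ∙ P) v v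
        ≡⟨ cong₂ _+_ (sym (outDegIn-induced sv)) (sum-cong-≗ through-repeat) ⟨
      sum (AH v) + (AH ∙ P) v v
        ≡⟨ ∑-distrib-+ (AH v) (λ y → AH v y * P y v) ⟨
      sum (λ y → AH v y + AH v y * P y v)
        ≡⟨ sum-cong-≗ (λ y → *-suc (AH v y) (P y v)) ⟨
      sum (λ y → AH v y * (1 + P y v))
        ≡⟨ ∙-congʳ AH walksUpTo≡1+P v v ⟨
      (AH ∙ walksUpTo G k) v v
        ≡⟨ adjacency-induced-commute-walksUpTo sv sv ⟩
      (walksUpTo G k ∙ AH) v v
        ≡⟨ ∙-congˡ AH walksUpTo≡1+P v v ⟩
      sum (λ y → AH y v + P v y * AH y v)
        ≡⟨ ∑-distrib-+ (λ y → AH y v) (λ y → P v y * AH y v) ⟩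
      sum (λ y → AH y v) + (P ∙ AH) v v
        ≡⟨ cong₂ _+_ (sym (inDegIn-induced sv)) (permutationMatrix-∙ r AH v v) ⟩
      inDegIn G S v + AH (r v) v
        ≡⟨ cong (inDegIn G S v +_) (adjacency-induced (S-r v sv) sv) ⟩
      inDegIn G S v + A (r v) v
        ∎)
      where
      open ≡-Reasoning
      A AH P : Matrix n
      A  = adjacency G
      AH = adjacency H
      P  = permutationMatrix r
      through-repeat : ∀ y → AH v y * P y v ≡ A v y * P y v
      through-repeat y with r y ≟ v
      ... | yes ry≡v = cong (_* P y v) (adjacency-induced sv (S-r⁻¹ y (subst (T ∘ S) (sym ry≡v) sv)))
      ... | no  ry≢v rewrite δ-≢ ry≢v = trans (*-zeroʳ (AH v y)) (sym (*-zeroʳ (A v y)))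

module AlmostMoore {d k : ℕ} {G : Digraph (mooreSum d k)} (almostMoore : IsAlmostMoore d k G)
                   {r : Fin' d k → Fin' d k} (repeat : IsRepeatMap G k r) where

  private
    n : ℕ
    n = mooreSum d k
    A P : Matrix n
    A = adjacency G
    P = permutationMatrix r
    regular : Diregular G d
    regular = proj₁ (proj₂ (proj₂ almostMoore))

  -- I + A + ⋯ + A^k = J + P: every entry is at least 1 (diameter k), the entry at the repeat is 2,
  -- and every row sums to 1 + n.
  walksUpTo≡1+P : ∀ u w → walksUpTo G k u w ≡ 1 + P u w
  walksUpTo≡1+P u w = sym (sum-mono-≤-≡⇒≗ lower sums w)
    where
    lower : ∀ w → 1 + P u w ≤ walksUpTo G k u w
    lower w with r u ≟ w
    ... | yes refl = ≤-reflexive (trans (cong suc (δ-refl (r u))) (sym (proj₁ (proj₁ (repeat u)))))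
    ... | no ru≢w with proj₁ (proj₂ (proj₂ (proj₂ almostMoore))) u w
    ...   | m , m≤k , 1≤walks =
      subst (_≤ walksUpTo G k u w) (cong suc (sym (δ-≢ ru≢w))) (≤-trans 1≤walks (walks≤walksUpTo G k u w m≤k))
    sums : sum (λ w → 1 + P u w) ≡ sum (walksUpTo G k u)
    sums = begin
      sum (λ w → 1 + P u w)          ≡⟨ ∑-distrib-+ (λ _ → 1) (P u) ⟩
      sum {n} (λ _ → 1) + sum (P u)  ≡⟨ cong₂ _+_ (trans (sum-const n 1) (*-identityʳ n)) (sum-δ (r u)) ⟩
      n + 1                          ≡⟨ +-comm n 1 ⟩
      1 + n                          ≡⟨ rowSum-walksUpTo G regular k u ⟨
      sum (walksUpTo G k u)          ∎
      where open ≡-Reasoning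

  colSum-P : ∀ w → sum (λ u → P u w) ≡ 1
  colSum-P w = +-cancelˡ-≡ n _ _ (begin
    n + sum (λ u → P u w)                  ≡⟨ cong (_+ sum (λ u → P u w)) (trans (sum-const n 1) (*-identityʳ n)) ⟨
    sum {n} (λ _ → 1) + sum (λ u → P u w)  ≡⟨ ∑-distrib-+ (λ _ → 1) (λ u → P u w) ⟨
    sum (λ u → 1 + P u w)                  ≡⟨ sum-cong-≗ (λ u → walksUpTo≡1+P u w) ⟨
    sum (λ u → walksUpTo G k u w)          ≡⟨ colSum-walksUpTo G regular k w ⟩
    1 + n                                  ≡⟨ +-comm 1 n ⟩
    n + 1                                  ∎)
    where open ≡-Reasoning

  repeat-injective : Injective _≡_ _≡_ r
  repeat-injective {a} {b} ra≡rb with a ≟ b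
  ... | yes a≡b = a≡b
  ... | no  a≢b = ⊥-elim (1+n≰n (begin
    2                      ≡⟨ cong₂ _+_ (δ-refl (r a)) (trans (cong (λ z → δ z (r a)) (sym ra≡rb)) (δ-refl (r a))) ⟨
    P a (r a) + P b (r a)  ≤⟨ sum-≥-pair (λ u → P u (r a)) a≢b ⟩
    sum (λ u → P u (r a))  ≡⟨ colSum-P (r a) ⟩
    1                      ∎))
    where open ≤-Reasoning

  adjacency-commute-P : Commute A P
  adjacency-commute-P u w = +-cancelˡ-≡ d _ _ (begin
    d + (A ∙ P) u w                    ≡⟨ cong (_+ (A ∙ P) u w) (rowSum-adjacency G regular u) ⟨
    sum (A u) + (A ∙ P) u w            ≡⟨ ∑-distrib-+ (A u) (λ y → A u y * P y w) ⟨
    sum (λ y → A u y + A u y * P y w)  ≡⟨ sum-cong-≗ (λ y → *-suc (A u y) (P y w)) ⟨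
    sum (λ y → A u y * (1 + P y w))    ≡⟨ ∙-congʳ A walksUpTo≡1+P u w ⟨
    (A ∙ walksUpTo G k) u w            ≡⟨ adjacency-commute-walksUpTo G k u w ⟩
    (walksUpTo G k ∙ A) u w            ≡⟨ ∙-congˡ A walksUpTo≡1+P u w ⟩
    sum (λ y → A y w + P u y * A y w)  ≡⟨ ∑-distrib-+ (λ y → A y w) (λ y → P u y * A y w) ⟩
    sum (λ y → A y w) + (P ∙ A) u w    ≡⟨ cong (_+ (P ∙ A) u w) (colSum-adjacency G regular w) ⟩
    d + (P ∙ A) u w                    ∎)
    where open ≡-Reasoning

  walks-repeat : ∀ j u w → walks G j (r u) (r w) ≡ walks G j u w
  walks-repeat j u w = begin
    walks G j (r u) (r w)              ≡⟨ permutationMatrix-∙ r (walks G j) u (r w) ⟨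
    (P ∙ walks G j) u (r w)            ≡⟨ walks-commute G adjacency-commute-P j u (r w) ⟨
    (walks G j ∙ P) u (r w)            ≡⟨ sum-cong-≗ (λ y → cong (walks G j u y *_) (δ-repeat y w)) ⟩
    sum (λ y → walks G j u y * δ y w)  ≡⟨ sum-δʳ w (walks G j u) ⟩
    walks G j u w                      ∎
    where
    open ≡-Reasoning
    δ-repeat : ∀ a b → δ (r a) (r b) ≡ δ a b
    δ-repeat = δ-injective repeat-injective

  walks-iter-repeat : ∀ M j u w → walks G j (iter r M u) (iter r M w) ≡ walks G j u w
  walks-iter-repeat zero    j u w = refl
  walks-iter-repeat (suc M) j u w = trans (walks-repeat j _ _) (walks-iter-repeat M j u w)

  walksUpTo≤2 : ∀ u w → walksUpTo G k u w ≤ 2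
  walksUpTo≤2 u w = ≤-trans (≤-reflexive (walksUpTo≡1+P u w)) (s≤s (δ-≤1 (r u) w))

  module _ {α : ℕ} (1≤α : 1 ≤ α) {S : Fin n → Bool}
           (S⇔InH : ∀ w → (T (S w) → InH r α w) × (InH r α w → T (S w))) where

    S-repeat : ∀ w → T (S w) → T (S (r w))
    S-repeat w = proj₂ (S⇔InH (r w))
               ∘ InH-respects r (λ j → ⇔-sym (iter-fixed-shift r repeat-injective j w))
               ∘ proj₁ (S⇔InH w)

    S-repeat⁻¹ : ∀ w → T (S (r w)) → T (S w)
    S-repeat⁻¹ w = proj₂ (S⇔InH w)
                 ∘ InH-respects r (λ j → iter-fixed-shift r repeat-injective j w)
                 ∘ proj₁ (S⇔InH (r w))

    noDetour : NoDetour G k S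
    noDetour {u} {w} {y} j l j+l≤k su sw ¬sy
      with InH⇒periodic r (proj₁ (S⇔InH u) su) | InH⇒periodic r (proj₁ (S⇔InH w) sw)
    ... | t₁ , u-periodic | t₂ , w-periodic = n<1⇒n≡0 (*-cancelˡ-< 3 _ 1 (s≤s (begin
      3 * c y              ≤⟨ sum-≥-orbit c (iter-injective r repeat-injective M) c-invariant ψψy≢y ⟩
      sum c                ≡⟨ walks-+ G j l u w ⟨
      walks G (j + l) u w  ≤⟨ walks≤walksUpTo G k u w j+l≤k ⟩
      walksUpTo G k u w    ≤⟨ walksUpTo≤2 u w ⟩
      2                    ∎)))
      where
      open ≤-Reasoning
      M : ℕ
      M = 2 ^ (t₁ + t₂) * α
      ψ : Fin n → Fin n
      ψ = iter r M
      ψu≡u : ψ u ≡ u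
      ψu≡u = u-periodic t₂
      ψw≡w : ψ w ≡ w
      ψw≡w = subst (λ t → iter r (2 ^ t * α) w ≡ w) (+-comm t₂ t₁) (w-periodic t₁)
      c : Fin n → ℕ
      c z = walks G j u z * walks G l z w
      c-invariant : ∀ z → c (ψ z) ≡ c z
      c-invariant z = cong₂ _*_ (trans (cong (λ x → walks G j x (ψ z)) (sym ψu≡u)) (walks-iter-repeat M j u z))
                                (trans (cong (walks G l (ψ z)) (sym ψw≡w)) (walks-iter-repeat M l z w))
      2M≡M+M : 2 ^ suc (t₁ + t₂) * α ≡ M + M
      2M≡M+M = trans (*-assoc 2 (2 ^ (t₁ + t₂)) α) (cong (M +_) (+-identityʳ M))
      ψψy≢y : ψ (ψ y) ≢ y
      ψψy≢y ψψy≡y = ¬sy (proj₂ (S⇔InH y) (periodic⇒InH r (suc (t₁ + t₂)) 1≤α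
        (trans (cong (λ p → iter r p y) 2M≡M+M) (trans (iter-+ r M M y) ψψy≡y))))

corollary2 : (d k : ℕ) (G : Digraph (mooreSum d k)) → IsAlmostMoore d k G →
    (r : Fin' d k → Fin' d k) → IsRepeatMap G k r →
    (α : ℕ) → 1 < α →
    (S : Fin' d k → Bool) → (∀ w → (T (S w) → InH r α w) × (InH r α w → T (S w))) →
    ∀ v → T (S v) → outDegIn G S v ≡ inDegIn G S v
corollary2 d k G almostMoore r repeat α 1<α S S⇔InH v =
  outDegIn≡inDegIn G S (noDetour 1≤α S⇔InH)
    walksUpTo≡1+P adjacency-commute-P (S-repeat 1≤α S⇔InH) (S-repeat⁻¹ 1≤α S⇔InH)
  where
  open AlmostMoore almostMoore repeat
  1≤α : 1 ≤ α
  1≤α = <⇒≤ 1<α
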